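{- Let $k$ be a positive integer, $a=6k+4$, $t=(a-2)/2$, $b=a+1$, $c=a+a/2$, $S=\{a,b,c\}$ and $G=\langle S\rangle$. Let $A_{0,k}=\{0\}$, $B_{0,k}=\emptyset$, and for $i\in[1,t]$ let $A_{i,k}=[ia,ia+i]$ and $B_{i,k}=A_{i-1,k}+\{c\}$. Let $H_{11,k}=\bigcup_{i=0}^{t}(A_{i,k}\cup B_{i,k})\cup[(t+1)a,\infty[$. Then: (1) $x\in G$ if and only if $x=(q+u)a+u\cdot\frac a2+r$ for some $q,r,u\in\mathbb{N}$ with $0\le r\le q$; (2) $G=H_{11,k}$; (3) $H_{11,k}$ is a $3$-permutation numerical semigroup.
   Context: For $u\le v$ in $\mathbb{N}$, $[u,v]=\{x\in\mathbb{N}: u\le x\le v\}$ and $[u,\infty[\,=\{x\in\mathbb{N}:x\ge u\}$; for sets $X,Y$, $X+Y=\{x+y:x\in X,y\in Y\}$. A numerical semigroup is a submonoid $G$ of $(\mathbb{N},+,0)$ with $\mathbb{N}\setminus G$ finite; $\langle S\rangle$ is the submonoid generated by $S$. Write the elements of $G$ as $0=g_0<g_1<g_2<\cdots$. For $n\ge 1$, $G$ is an $n$-permutation numerical semigroup if $G=\langle g_1,\dots,g_n\rangle$ and for every integer $k\ge 0$ the tuple $(g_{kn+1}\bmod n,\dots,g_{kn+n}\bmod n)$ contains exactly one representative of each residue class of $\mathbb{Z}/n\mathbb{Z}$. -}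

module Defs where

open import Data.Nat using (ℕ; zero; suc; NonZero; _+_; _*_; _∸_; _≤_; _<_)
open import Data.Nat.DivMod using (_/_; _%_)
open import Data.Product using (Σ; ∃; _×_; _,_)
open import Data.Sum using (_⊎_)
open import Data.Empty using (⊥)
open import Relation.Binary.PropositionalEquality using (_≡_)
open import Function.Bundles using (_⇔_)

data ⟨_⟩ (S : ℕ → Set) : ℕ → Set where
  gen-zero : ⟨ S ⟩ 0
  gen-add  : ∀ {s x} → S s → ⟨ S ⟩ x → ⟨ S ⟩ (s + x)

record IsNumericalSemigroup (G : ℕ → Set) : Set where
  field
    has-zero : G 0
    closed-+ : ∀ {x y} → G x → G y → G (x + y)
    cofinite : ∃ λ N → ∀ x → N ≤ x → G x

record Enumerates (g : ℕ → ℕ) (G : ℕ → Set) : Set where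
  field
    strictly-increasing : ∀ i → g i < g (suc i)
    in-G                : ∀ i → G (g i)
    covers              : ∀ x → G x → ∃ λ i → g i ≡ x

IsPermutationNS : (n : ℕ) → .⦃ _ : NonZero n ⦄ → (ℕ → Set) → Set
IsPermutationNS n G =
  IsNumericalSemigroup G ×
  Σ (ℕ → ℕ) λ g → Enumerates g G ×
    (∀ x → G x ⇔ ⟨ (λ s → ∃ λ j → 1 ≤ j × j ≤ n × s ≡ g j) ⟩ x) ×
    (∀ k ρ → ρ < n →
      (∃ λ j → 1 ≤ j × j ≤ n × g (k * n + j) % n ≡ ρ) ×
      (∀ j j' → 1 ≤ j → j ≤ n → 1 ≤ j' → j' ≤ n →
         g (k * n + j) % n ≡ ρ → g (k * n + j') % n ≡ ρ → j ≡ j'))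

aₖ : ℕ → ℕ
aₖ k = 6 * k + 4

tₖ : ℕ → ℕ
tₖ k = (aₖ k ∸ 2) / 2

bₖ : ℕ → ℕ
bₖ k = aₖ k + 1

cₖ : ℕ → ℕ
cₖ k = aₖ k + aₖ k / 2

Sₖ : ℕ → ℕ → Set
Sₖ k s = s ≡ aₖ k ⊎ s ≡ bₖ k ⊎ s ≡ cₖ k

Gₖ : ℕ → ℕ → Set
Gₖ k = ⟨ Sₖ k ⟩

A : ℕ → ℕ → ℕ → Set
A k zero x = x ≡ 0
A k (suc i) x = suc i * aₖ k ≤ x × x ≤ suc i * aₖ k + suc i

B : ℕ → ℕ → ℕ → Set
B k zero x = ⊥
B k (suc i) x = ∃ λ y → A k i y × x ≡ y + cₖ k

H11 : ℕ → ℕ → Set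
H11 k x = (∃ λ i → i ≤ tₖ k × (A k i x ⊎ B k i x)) ⊎ (suc (tₖ k) * aₖ k ≤ x)

{-# OPTIONS --safe #-}
-- Counting the generators a, a + 1 and c = a + h (h = a/2) used to write x gives the normal
-- form x = (q + u)a + uh + r with r ≤ q. Since 2c = 3a one may take u ≤ 1, and the normal
-- forms with u = 0 resp. u = 1 and q ≤ t are exactly the blocks Aᵢ resp. Bᵢ, and every
-- x ≥ (t + 1)a has a normal form as well. Listing A₀, A₁, B₁, A₂, B₂, … in increasing order, block
-- Aᵢ ∪ Bᵢ starts at index i². Inside a block consecutive elements differ by 1, and the jumps
-- between blocks are ≡ 1 (mod 3) except at indices divisible by 3, so each triple
-- g₃ₘ₊₁, g₃ₘ₊₂, g₃ₘ₊₃ runs through three consecutive residues.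
module Submission where

open import Defs
open import Data.Nat
  using (ℕ; zero; suc; pred; _+_; _*_; _∸_; _≤_; _<_; z≤n; s≤s; z<s; _<?_; _≤?_;
         NonZero; >-nonZero; >-nonZero⁻¹)
open import Data.Nat.Properties
open import Data.Nat.DivMod
  using (_/_; _%_; _divMod_; result; m≡m%n+[m/n]*n; m%n<n; m<n⇒m%n≡m; [m+kn]%n≡m%n;
         m%n%n≡m%n; %-distribˡ-+; m*n/n≡m)
open import Data.Nat.Divisibility using (divides; n∣m⇒m%n≡0)
open import Data.Nat.Tactic.RingSolver using (solve; solve-∀)
open import Data.Fin using (zero; suc)
open import Data.List using (_∷_; [])
open import Data.Product using (∃; _×_; _,_)
open import Data.Sum using (_⊎_; inj₁; inj₂)
open import Data.Unit using (⊤; tt)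
open import Relation.Nullary using (yes; no; contradiction)
open import Relation.Binary.PropositionalEquality
open import Function.Bundles using (_⇔_; mk⇔; Equivalence)
open import Function.Construct.Composition using (_⇔-∘_)
open import Function.Construct.Symmetry using (⇔-sym)

⟨⟩-+ : ∀ {S x y} → ⟨ S ⟩ x → ⟨ S ⟩ y → ⟨ S ⟩ (x + y)
⟨⟩-+ gen-zero gy = gy
⟨⟩-+ {S} {y = y} (gen-add {s} {x} s∈S gx) gy =
  subst ⟨ S ⟩ (sym (+-assoc s x y)) (gen-add s∈S (⟨⟩-+ gx gy))

⟨⟩-*-+ : ∀ {S s y} → S s → ∀ n → ⟨ S ⟩ y → ⟨ S ⟩ (n * s + y)
⟨⟩-*-+ s∈S zero gy = gy
⟨⟩-*-+ {S} {s} {y} s∈S (suc n) gy =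
  subst ⟨ S ⟩ (sym (+-assoc s (n * s) y)) (gen-add s∈S (⟨⟩-*-+ s∈S n gy))

⟨⟩-map : ∀ {S S' : ℕ → Set} → (∀ {s} → S s → S' s) →
  ∀ {x} → ⟨ S ⟩ x → ⟨ S' ⟩ x
⟨⟩-map f gen-zero = gen-zero
⟨⟩-map f (gen-add s∈S gx) = gen-add (f s∈S) (⟨⟩-map f gx)

⟨⟩-cong : ∀ {S S' : ℕ → Set} → (∀ s → S s ⇔ S' s) →
  ∀ x → ⟨ S ⟩ x ⇔ ⟨ S' ⟩ x
⟨⟩-cong S⇔S' x =
  mk⇔ (⟨⟩-map (Equivalence.to (S⇔S' _))) (⟨⟩-map (Equivalence.from (S⇔S' _)))

GenSet : ℕ → ℕ → ℕ → Set
GenSet a H s = s ≡ a ⊎ s ≡ a + 1 ⊎ s ≡ a + H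

NormalForm : ℕ → ℕ → ℕ → Set
NormalForm a H x = ∃ λ q → ∃ λ r → ∃ λ u → r ≤ q × x ≡ (q + u) * a + u * H + r

generated⇒normal-form : ∀ {a H x} → ⟨ GenSet a H ⟩ x → NormalForm a H x
generated⇒normal-form gen-zero = 0 , 0 , 0 , z≤n , refl
generated⇒normal-form {a} {H} (gen-add (inj₁ refl) gx) with generated⇒normal-form gx
... | q , r , u , r≤q , refl =
  suc q , r , u , m≤n⇒m≤1+n r≤q , solve (a ∷ H ∷ q ∷ r ∷ u ∷ [])
generated⇒normal-form {a} {H} (gen-add (inj₂ (inj₁ refl)) gx) with generated⇒normal-form gx
... | q , r , u , r≤q , refl =
  suc q , suc r , u , s≤s r≤q , solve (a ∷ H ∷ q ∷ r ∷ u ∷ [])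
generated⇒normal-form {a} {H} (gen-add (inj₂ (inj₂ refl)) gx) with generated⇒normal-form gx
... | q , r , u , r≤q , refl =
  q , r , suc u , r≤q , solve (a ∷ H ∷ q ∷ r ∷ u ∷ [])

-- The r ≤ q extra units are attached to r of the q copies of a, making them copies of a + 1.
normal-form⇒generated : ∀ {a H x} → NormalForm a H x → ⟨ GenSet a H ⟩ x
normal-form⇒generated {a} {H} (q , r , u , r≤q , refl) with m≤n⇒∃[o]m+o≡n r≤q
... | e , refl =
  subst ⟨ GenSet a H ⟩ regroup
    (⟨⟩-*-+ (inj₁ refl) e
      (⟨⟩-*-+ (inj₂ (inj₁ refl)) r
        (⟨⟩-*-+ (inj₂ (inj₂ refl)) u gen-zero)))
  where
  regroup : e * a + (r * (a + 1) + (u * (a + H) + 0)) ≡ (r + e + u) * a + u * H + r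
  regroup = solve (a ∷ H ∷ e ∷ r ∷ u ∷ [])

generated⇔normal-form : ∀ a H x → ⟨ GenSet a H ⟩ x ⇔ NormalForm a H x
generated⇔normal-form a H x = mk⇔ generated⇒normal-form normal-form⇒generated

%-+-cong : ∀ {x x' y y'} n .{{_ : NonZero n}} →
  x % n ≡ x' % n → y % n ≡ y' % n → (x + y) % n ≡ (x' + y') % n
%-+-cong {x} {x'} {y} {y'} n x≡x' y≡y' = begin
  (x + y) % n            ≡⟨ %-distribˡ-+ x y n ⟩
  (x % n + y % n) % n    ≡⟨ cong₂ (λ u v → (u + v) % n) x≡x' y≡y' ⟩
  (x' % n + y' % n) % n  ≡⟨ %-distribˡ-+ x' y' n ⟨
  (x' + y') % n          ∎
  where open ≡-Reasoning

m+jn≡o+kn⇒m%n≡o%n : ∀ {m o} j k n .{{_ : NonZero n}} →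
  m + j * n ≡ o + k * n → m % n ≡ o % n
m+jn≡o+kn⇒m%n≡o%n {m} {o} j k n eq = begin
  m % n            ≡⟨ [m+kn]%n≡m%n m j n ⟨
  (m + j * n) % n  ≡⟨ cong (_% n) eq ⟩
  (o + k * n) % n  ≡⟨ [m+kn]%n≡m%n o k n ⟩
  o % n            ∎
  where open ≡-Reasoning

AllResiduesOnce : (n : ℕ) .{{_ : NonZero n}} → (ℕ → ℕ) → Set
AllResiduesOnce n f = ∀ ρ → ρ < n →
  (∃ λ j → 1 ≤ j × j ≤ n × f j % n ≡ ρ) ×
  (∀ j j' → 1 ≤ j → j ≤ n → 1 ≤ j' → j' ≤ n →
     f j % n ≡ ρ → f j' % n ≡ ρ → j ≡ j')

-- Writing n = m + 1, adding m * f 1 undoes the shift by f 1 modulo n.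
consecutive⇒all-residues-once : ∀ n .{{_ : NonZero n}} (f : ℕ → ℕ) →
  (∀ j → 1 ≤ j → j < n → f (suc j) % n ≡ suc (f j) % n) → AllResiduesOnce n f
consecutive⇒all-residues-once n@(suc m) f step ρ ρ<n =
  (suc d₀ , s≤s z≤n , m%n<n (ρ + m * f 1) n , hits-ρ) , unique
  where
  open ≡-Reasoning

  offset : ∀ d → d < n → f (suc d) % n ≡ (f 1 + d) % n
  offset zero _ = cong (_% n) (sym (+-identityʳ (f 1)))
  offset (suc d) d+1<n = begin
    f (suc (suc d)) % n  ≡⟨ step (suc d) (s≤s z≤n) d+1<n ⟩
    suc (f (suc d)) % n  ≡⟨ %-+-cong {1} {1} n refl (offset d (≤-trans (n≤1+n _) d+1<n)) ⟩
    suc (f 1 + d) % n    ≡⟨ cong (_% n) (+-suc (f 1) d) ⟨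
    (f 1 + suc d) % n    ∎

  regroup : ∀ r d m → r + d + m * r ≡ d + r * suc m
  regroup = solve-∀

  unshift : ∀ d → d < n → (f 1 + d + m * f 1) % n ≡ d
  unshift d d<n = begin
    (f 1 + d + m * f 1) % n  ≡⟨ cong (_% n) (regroup (f 1) d m) ⟩
    (d + f 1 * n) % n        ≡⟨ [m+kn]%n≡m%n d (f 1) n ⟩
    d % n                    ≡⟨ m<n⇒m%n≡m d<n ⟩
    d                        ∎

  d₀ : ℕ
  d₀ = (ρ + m * f 1) % n

  hits-ρ : f (suc d₀) % n ≡ ρ
  hits-ρ = begin
    f (suc d₀) % n               ≡⟨ offset d₀ (m%n<n (ρ + m * f 1) n) ⟩
    (f 1 + d₀) % n               ≡⟨ %-+-cong {f 1} {f 1} n refl (m%n%n≡m%n (ρ + m * f 1) n) ⟩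
    (f 1 + (ρ + m * f 1)) % n    ≡⟨ cong (_% n) (+-assoc (f 1) ρ _) ⟨
    (f 1 + ρ + m * f 1) % n      ≡⟨ unshift ρ ρ<n ⟩
    ρ                            ∎

  unique : ∀ j j' → 1 ≤ j → j ≤ n → 1 ≤ j' → j' ≤ n →
    f j % n ≡ ρ → f j' % n ≡ ρ → j ≡ j'
  unique (suc d) (suc d') _ d<n _ d'<n fj≡ρ fj'≡ρ = cong suc (begin
    d                          ≡⟨ unshift d d<n ⟨
    (f 1 + d + m * f 1) % n    ≡⟨ %-+-cong {f 1 + d} {f 1 + d'} n same-residue refl ⟩
    (f 1 + d' + m * f 1) % n   ≡⟨ unshift d' d'<n ⟩
    d'                         ∎)
    where
    same-residue : (f 1 + d) % n ≡ (f 1 + d') % n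
    same-residue = trans (sym (offset d d<n))
                   (trans fj≡ρ (trans (sym fj'≡ρ) (offset d' d'<n)))

Enumerates-⇔ : ∀ {g G G'} → (∀ x → G x ⇔ G' x) → Enumerates g G → Enumerates g G'
Enumerates-⇔ G⇔G' e = record
  { strictly-increasing = strictly-increasing
  ; in-G   = λ i → Equivalence.to (G⇔G' _) (in-G i)
  ; covers = λ x x∈G' → covers x (Equivalence.from (G⇔G' x) x∈G')
  }
  where open Enumerates e

normal-form-u≡0 : ∀ a H q r → (q + 0) * a + 0 * H + r ≡ q * a + r
normal-form-u≡0 = solve-∀

normal-form-u≡1 : ∀ a H q r → (q + 1) * a + 1 * H + r ≡ suc q * a + H + r
normal-form-u≡1 = solve-∀

-- The set ⋃ᵢ₌₀ᵀ (Aᵢ ∪ Bᵢ) ∪ [(T+1)a, ∞[ for a = 2h, h = T + 1, where Aᵢ = [ia, ia+i]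
-- and Bᵢ = Aᵢ₋₁ + (a + h) = [ia + h, ia + h + i - 1], listed block by block in
-- increasing order.
module Staircase (T a : ℕ) (1≤T : 1 ≤ T) (a≡h+h : a ≡ suc T + suc T) where

  h : ℕ
  h = suc T

  instance
    a-nonZero : NonZero a
    a-nonZero = >-nonZero (subst (0 <_) (sym a≡h+h) z<s)

  data Position : Set where
    inA    : (i d : ℕ) → Position
    inB    : (i e : ℕ) → Position
    inTail : (m : ℕ) → Position

  Valid : Position → Set
  Valid (inA i d)  = d ≤ i × i ≤ T
  Valid (inB i e)  = e < i × i ≤ T
  Valid (inTail m) = ⊤

  value : Position → ℕ
  value (inA i d)  = i * a + d
  value (inB i e)  = i * a + h + e
  value (inTail m) = suc T * a + m

  -- The rank of the value in the listing: Aⱼ ∪ Bⱼ has 2j + 1 elements, so i² elements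
  -- precede Aᵢ.
  index : Position → ℕ
  index (inA i d)  = i * i + d
  index (inB i e)  = i * i + i + suc e
  index (inTail m) = suc T * suc T + m

  HasPosition : ℕ → Set
  HasPosition x = ∃ λ p → Valid p × value p ≡ x

  tail-position : ∀ {x} → suc T * a ≤ x → HasPosition x
  tail-position le with m≤n⇒∃[o]m+o≡n le
  ... | m , eq = inTail m , tt , eq

  -- Two copies of c = a + h make three copies of a, because a = 2h.
  normal-form-reduce : ∀ q u r →
    (3 + q + u) * a + u * h + r ≡ (q + suc (suc u)) * a + suc (suc u) * h + r
  normal-form-reduce q u r =
    subst (λ a → (3 + q + u) * a + u * h + r ≡ (q + suc (suc u)) * a + suc (suc u) * h + r)
          (sym a≡h+h) (identity h q u r)
    where
    identity : ∀ h q u r →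
      (3 + q + u) * (h + h) + u * h + r ≡ (q + suc (suc u)) * (h + h) + suc (suc u) * h + r
    identity = solve-∀

  normal-form-position : ∀ q r u → r ≤ q → HasPosition ((q + u) * a + u * h + r)
  normal-form-position q r zero r≤q with q ≤? T
  ... | yes q≤T = inA q r , (r≤q , q≤T) , sym (normal-form-u≡0 a h q r)
  ... | no  q≰T = tail-position (begin
    suc T * a                ≤⟨ *-monoˡ-≤ a (≰⇒> q≰T) ⟩
    q * a                    ≤⟨ m≤m+n (q * a) r ⟩
    q * a + r                ≡⟨ normal-form-u≡0 a h q r ⟨
    (q + 0) * a + 0 * h + r  ∎)
    where open ≤-Reasoning
  normal-form-position q r (suc zero) r≤q with suc q ≤? T
  ... | yes q<T = inB (suc q) r , (s≤s r≤q , q<T) , sym (normal-form-u≡1 a h q r)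
  ... | no  q≮T = tail-position (begin
    suc T * a                ≤⟨ *-monoˡ-≤ a (≰⇒> q≮T) ⟩
    suc q * a                ≤⟨ m≤m+n (suc q * a) h ⟩
    suc q * a + h            ≤⟨ m≤m+n (suc q * a + h) r ⟩
    suc q * a + h + r        ≡⟨ normal-form-u≡1 a h q r ⟨
    (q + 1) * a + 1 * h + r  ∎)
    where open ≤-Reasoning
  normal-form-position q r (suc (suc u)) r≤q =
    subst HasPosition (normal-form-reduce q u r)
      (normal-form-position (3 + q) r u (≤-trans r≤q (m≤n+m q 3)))

  tail-normal-form : ∀ m → NormalForm a h (suc T * a + m)
  tail-normal-form m with m % a | m / a | m≡m%n+[m/n]*n m a | m%n<n m a
  ... | s | p | refl | s<a with s <? h
  ...   | yes s<h = suc T + p , s , 0 , ≤-trans (<⇒≤ s<h) (m≤m+n h p) ,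
                    trans (regroup (suc T) a s p) (sym (normal-form-u≡0 a h (suc T + p) s))
    where
    regroup : ∀ t a s p → t * a + (s + p * a) ≡ (t + p) * a + s
    regroup = solve-∀
  ...   | no  s≮h with m≤n⇒∃[o]m+o≡n (≮⇒≥ s≮h)
  ...     | e , refl = T + p , e , 1 , ≤-trans e≤T (m≤m+n T p) ,
                       trans (regroup T a e p) (sym (normal-form-u≡1 a h (T + p) e))
    where
    regroup : ∀ T a e p → suc T * a + (suc T + e + p * a) ≡ suc (T + p) * a + suc T + e
    regroup = solve-∀
    e≤T : e ≤ T
    e≤T = ≤-pred (+-cancelˡ-< h e h (subst (h + e <_) a≡h+h s<a))

  position⇒normal-form : ∀ p → Valid p → NormalForm a h (value p)
  position⇒normal-form (inA i d) (d≤i , _) = i , d , 0 , d≤i , sym (normal-form-u≡0 a h i d)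
  position⇒normal-form (inB zero e) (() , _)
  position⇒normal-form (inB (suc i) e) (s≤s e≤i , _) =
    i , e , 1 , e≤i , sym (normal-form-u≡1 a h i e)
  position⇒normal-form (inTail m) _ = tail-normal-form m

  normal-form⇔position : ∀ x → NormalForm a h x ⇔ HasPosition x
  normal-form⇔position x =
    mk⇔ (λ { (q , r , u , r≤q , refl) → normal-form-position q r u r≤q })
        (λ { (p , valid , refl) → position⇒normal-form p valid })

  infix 4 _⟶_
  data _⟶_ : Position → Position → Set where
    A-step    : ∀ {i d} → d < i → i ≤ T → inA i d ⟶ inA i (suc d)
    A₀-end    : inA 0 0 ⟶ inA 1 0
    A-end     : ∀ {i} → suc i ≤ T → inA (suc i) (suc i) ⟶ inB (suc i) 0
    B-step    : ∀ {i e} → suc e < i → i ≤ T → inB i e ⟶ inB i (suc e)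
    B-end     : ∀ {i} → suc i < T → inB (suc i) i ⟶ inA (suc (suc i)) 0
    B-last    : ∀ {i} → suc i ≡ T → inB (suc i) i ⟶ inTail 0
    tail-step : ∀ {m} → inTail m ⟶ inTail (suc m)

  ⟶-functional : ∀ {p q q'} → p ⟶ q → p ⟶ q' → q ≡ q'
  ⟶-functional (A-step _ _)   (A-step _ _)   = refl
  ⟶-functional (A-step () _)  A₀-end
  ⟶-functional (A-step i<i _) (A-end _)      = contradiction i<i (n≮n _)
  ⟶-functional A₀-end         (A-step () _)
  ⟶-functional A₀-end         A₀-end         = refl
  ⟶-functional (A-end _)      (A-step i<i _) = contradiction i<i (n≮n _)
  ⟶-functional (A-end _)      (A-end _)      = refl
  ⟶-functional (B-step _ _)   (B-step _ _)   = refl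
  ⟶-functional (B-step i<i _) (B-end _)      = contradiction i<i (n≮n _)
  ⟶-functional (B-step i<i _) (B-last _)     = contradiction i<i (n≮n _)
  ⟶-functional (B-end _)      (B-step i<i _) = contradiction i<i (n≮n _)
  ⟶-functional (B-end _)      (B-end _)      = refl
  ⟶-functional (B-end i<T)    (B-last i≡T)   = contradiction i≡T (<⇒≢ i<T)
  ⟶-functional (B-last _)     (B-step i<i _) = contradiction i<i (n≮n _)
  ⟶-functional (B-last i≡T)   (B-end i<T)    = contradiction i≡T (<⇒≢ i<T)
  ⟶-functional (B-last _)     (B-last _)     = refl
  ⟶-functional tail-step      tail-step      = refl

  ⟶-valid : ∀ {p q} → p ⟶ q → Valid q
  ⟶-valid (A-step d<i i≤T) = d<i , i≤T
  ⟶-valid A₀-end           = z≤n , 1≤T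
  ⟶-valid (A-end i≤T)      = z<s , i≤T
  ⟶-valid (B-step e<i i≤T) = e<i , i≤T
  ⟶-valid (B-end i<T)      = z≤n , i<T
  ⟶-valid (B-last _)       = tt
  ⟶-valid tail-step        = tt

  B-end-increasing : ∀ i → i < h → suc i * a + h + i < suc (suc i) * a + 0
  B-end-increasing i i<h = begin-strict
    suc i * a + h + i      ≡⟨ +-assoc (suc i * a) h i ⟩
    suc i * a + (h + i)    <⟨ +-monoʳ-< (suc i * a) (+-monoʳ-< h i<h) ⟩
    suc i * a + (h + h)    ≡⟨ cong (suc i * a +_) a≡h+h ⟨
    suc i * a + a          ≡⟨ +-comm (suc i * a) a ⟩
    suc (suc i) * a        ≡⟨ +-identityʳ _ ⟨
    suc (suc i) * a + 0    ∎
    where open ≤-Reasoning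

  ⟶-increasing : ∀ {p q} → p ⟶ q → value p < value q
  ⟶-increasing {inA i d} (A-step _ _) = +-monoʳ-< (i * a) (n<1+n d)
  ⟶-increasing A₀-end =
    subst (0 <_) (sym (trans (+-identityʳ (1 * a)) (*-identityˡ a))) (>-nonZero⁻¹ a)
  ⟶-increasing {inA (suc i) _} (A-end i<T) =
    subst (suc i * a + suc i <_) (sym (+-identityʳ _)) (+-monoʳ-< (suc i * a) (s≤s i<T))
  ⟶-increasing {inB i e} (B-step _ _) = +-monoʳ-< (i * a + h) (n<1+n e)
  ⟶-increasing (B-end {i} i+1<T) =
    B-end-increasing i (s≤s (≤-trans (n≤1+n i) (<⇒≤ i+1<T)))
  ⟶-increasing (B-last {i} i+1≡T) =
    subst (λ t → suc i * a + h + i < suc t * a + 0) i+1≡T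
      (B-end-increasing i (s≤s (≤-trans (n≤1+n i) (≤-reflexive i+1≡T))))
  ⟶-increasing {inTail m} tail-step = +-monoʳ-< (suc T * a) (n<1+n m)

  next-block-index : ∀ i → suc i * suc i + 0 ≡ suc (i * i + i + i)
  next-block-index = solve-∀

  ⟶-index : ∀ {p q} → p ⟶ q → index q ≡ suc (index p)
  ⟶-index {inA i d} (A-step _ _)    = +-suc (i * i) d
  ⟶-index A₀-end                    = refl
  ⟶-index {inA (suc i) _} (A-end _) = +-comm _ 1
  ⟶-index {inB i e} (B-step _ _)    = +-suc (i * i + i) (suc e)
  ⟶-index (B-end {i} _)             = next-block-index (suc i)
  ⟶-index (B-last {i} i+1≡T)        =
    subst (λ t → suc t * suc t + 0 ≡ _) i+1≡T (next-block-index (suc i))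
  ⟶-index {inTail m} tail-step      = +-suc (suc T * suc T) m

  next : Position → Position
  next (inA zero d) = inA 1 0
  next (inA (suc i) d) with d <? suc i
  ... | yes _ = inA (suc i) (suc d)
  ... | no _  = inB (suc i) 0
  next (inB i e) with suc e <? i | i <? T
  ... | yes _ | _     = inB i (suc e)
  ... | no _  | yes _ = inA (suc i) 0
  ... | no _  | no _  = inTail 0
  next (inTail m) = inTail (suc m)

  next-⟶ : ∀ p → Valid p → p ⟶ next p
  next-⟶ (inA zero .zero) (z≤n , _) = A₀-end
  next-⟶ (inA (suc i) d) (d≤i , i<T) with d <? suc i
  ... | yes d<i = A-step d<i i<T
  ... | no d≮i with ≤∧≮⇒≡ d≤i d≮i
  ...   | refl = A-end i<T
  next-⟶ (inB i e) (e<i , i≤T) with suc e <? i | i <? T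
  ... | yes e+1<i | _ = B-step e+1<i i≤T
  ... | no e+1≮i | yes i<T with ≤∧≮⇒≡ e<i e+1≮i
  ...   | refl = B-end i<T
  next-⟶ (inB i e) (e<i , i≤T) | no e+1≮i | no i≮T with ≤∧≮⇒≡ e<i e+1≮i
  ...   | refl = B-last (≤∧≮⇒≡ i≤T i≮T)
  next-⟶ (inTail m) _ = tail-step

  walk : ℕ → Position
  walk zero    = inA 0 0
  walk (suc n) = next (walk n)

  walk-valid : ∀ n → Valid (walk n)
  walk-valid zero    = z≤n , z≤n
  walk-valid (suc n) = ⟶-valid (next-⟶ (walk n) (walk-valid n))

  walk-⟶ : ∀ n → walk n ⟶ walk (suc n)
  walk-⟶ n = next-⟶ (walk n) (walk-valid n)

  index-walk : ∀ n → index (walk n) ≡ n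
  index-walk zero    = refl
  index-walk (suc n) = trans (⟶-index (walk-⟶ n)) (cong suc (index-walk n))

  Reached : Position → Set
  Reached p = ∃ λ n → walk n ≡ p

  reached-⟶ : ∀ {p q} → p ⟶ q → Reached p → Reached q
  reached-⟶ p⟶q (n , refl) = suc n , ⟶-functional (walk-⟶ n) p⟶q

  reached-run : ∀ (f : ℕ → Position) m → (∀ d → d < m → f d ⟶ f (suc d)) →
    Reached (f 0) → ∀ d → d ≤ m → Reached (f d)
  reached-run f m step reached₀ zero    _   = reached₀
  reached-run f m step reached₀ (suc d) d<m =
    reached-⟶ (step d d<m) (reached-run f m step reached₀ d (<⇒≤ d<m))

  reached-A : ∀ {i} → i ≤ T → Reached (inA i 0) → ∀ d → d ≤ i → Reached (inA i d)
  reached-A i≤T = reached-run (inA _) _ (λ d d<i → A-step d<i i≤T)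

  reached-B : ∀ {i} → suc i ≤ T → Reached (inA (suc i) 0) →
    ∀ e → e ≤ i → Reached (inB (suc i) e)
  reached-B i<T reachedA =
    reached-run (inB _) _ (λ e e<i → B-step (s≤s e<i) i<T)
      (reached-⟶ (A-end i<T) (reached-A i<T reachedA _ ≤-refl))

  reached-block : ∀ i → i ≤ T → Reached (inA i 0)
  reached-block zero          _     = 0 , refl
  reached-block (suc zero)    _     = reached-⟶ A₀-end (0 , refl)
  reached-block (suc (suc i)) i+1<T =
    reached-⟶ (B-end i+1<T) (reached-B i<T (reached-block (suc i) i<T) i ≤-refl)
    where
    i<T : suc i ≤ T
    i<T = <⇒≤ i+1<T

  reached-tail : ∀ m → Reached (inTail m)
  reached-tail zero    =
    reached-⟶ (B-last T-1+1≡T) (reached-B T-1<T (reached-block _ T-1<T) _ ≤-refl)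
    where
    instance _ = >-nonZero 1≤T
    T-1+1≡T : suc (pred T) ≡ T
    T-1+1≡T = suc-pred T
    T-1<T : suc (pred T) ≤ T
    T-1<T = ≤-reflexive T-1+1≡T
  reached-tail (suc m) = reached-⟶ tail-step (reached-tail m)

  reached-valid : ∀ p → Valid p → Reached p
  reached-valid (inA i d) (d≤i , i≤T) = reached-A i≤T (reached-block i i≤T) d d≤i
  reached-valid (inB zero e) (() , _)
  reached-valid (inB (suc i) e) (s≤s e≤i , i<T) =
    reached-B i<T (reached-block (suc i) i<T) e e≤i
  reached-valid (inTail m) _ = reached-tail m

  walk-enumerates : Enumerates (λ n → value (walk n)) HasPosition
  walk-enumerates = record
    { strictly-increasing = λ n → ⟶-increasing (walk-⟶ n)
    ; in-G   = λ n → walk n , walk-valid n , refl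
    ; covers = λ { x (p , valid , refl) → let n , walk-n≡p = reached-valid p valid
                                           in n , cong value walk-n≡p }
    }

module Family (k : ℕ) where

  T : ℕ
  T = 3 * k + 1

  aₖ≡h+h : aₖ k ≡ suc T + suc T
  aₖ≡h+h = identity k
    where
    identity : ∀ k → 6 * k + 4 ≡ suc (3 * k + 1) + suc (3 * k + 1)
    identity = solve-∀

  open Staircase T (aₖ k) (m≤n+m 1 (3 * k)) aₖ≡h+h

  tₖ≡T : tₖ k ≡ T
  tₖ≡T = begin
    (aₖ k ∸ 2) / 2        ≡⟨ cong (λ x → (x ∸ 2) / 2) (identity k) ⟩
    (T * 2 + 2 ∸ 2) / 2   ≡⟨ cong (_/ 2) (m+n∸n≡m (T * 2) 2) ⟩
    T * 2 / 2             ≡⟨ m*n/n≡m T 2 ⟩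
    T                     ∎
    where
    open ≡-Reasoning
    identity : ∀ k → 6 * k + 4 ≡ (3 * k + 1) * 2 + 2
    identity = solve-∀

  aₖ/2≡h : aₖ k / 2 ≡ h
  aₖ/2≡h = trans (cong (_/ 2) (trans aₖ≡h+h (+-*-2 h))) (m*n/n≡m h 2)
    where
    +-*-2 : ∀ h → h + h ≡ h * 2
    +-*-2 = solve-∀

  A-elements : ∀ {i x} → A k i x → ∃ λ d → d ≤ i × i * aₖ k + d ≡ x
  A-elements {zero}  refl = 0 , z≤n , refl
  A-elements {suc i} (lo , hi) with m≤n⇒∃[o]m+o≡n lo
  ... | d , refl = d , +-cancelˡ-≤ (suc i * aₖ k) d (suc i) hi , refl

  A-intro : ∀ {i d} → d ≤ i → A k i (i * aₖ k + d)
  A-intro {zero}      z≤n = refl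
  A-intro {suc i} {d} d≤i = m≤m+n (suc i * aₖ k) d , +-monoʳ-≤ (suc i * aₖ k) d≤i

  B-value : ∀ i d → i * aₖ k + d + cₖ k ≡ suc i * aₖ k + h + d
  B-value i d = begin
    i * aₖ k + d + (aₖ k + aₖ k / 2)  ≡⟨ cong (λ z → i * aₖ k + d + (aₖ k + z)) aₖ/2≡h ⟩
    i * aₖ k + d + (aₖ k + h)         ≡⟨ regroup (aₖ k) h i d ⟩
    suc i * aₖ k + h + d              ∎
    where
    open ≡-Reasoning
    regroup : ∀ a h i d → i * a + d + (a + h) ≡ (a + i * a) + h + d
    regroup = solve-∀

  H11⇒position : ∀ {x} → H11 k x → HasPosition x
  H11⇒position (inj₁ (i , i≤t , inj₁ x∈A)) with A-elements x∈A
  ... | d , d≤i , eq = inA i d , (d≤i , subst (i ≤_) tₖ≡T i≤t) , eq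
  H11⇒position (inj₁ (zero , _ , inj₂ ()))
  H11⇒position (inj₁ (suc i , i<t , inj₂ (y , y∈A , refl))) with A-elements y∈A
  ... | d , d≤i , refl =
    inB (suc i) d , (s≤s d≤i , subst (suc i ≤_) tₖ≡T i<t) , sym (B-value i d)
  H11⇒position {x} (inj₂ t<x) =
    tail-position (subst (λ t → suc t * aₖ k ≤ x) tₖ≡T t<x)

  position⇒H11 : ∀ p → Valid p → H11 k (value p)
  position⇒H11 (inA i d) (d≤i , i≤T) = inj₁ (i , i≤t , inj₁ (A-intro d≤i))
    where i≤t = subst (i ≤_) (sym tₖ≡T) i≤T
  position⇒H11 (inB zero e) (() , _)
  position⇒H11 (inB (suc i) e) (s≤s e≤i , i<T) =
    inj₁ (suc i , i<t , inj₂ (i * aₖ k + e , A-intro e≤i , sym (B-value i e)))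
    where i<t = subst (suc i ≤_) (sym tₖ≡T) i<T
  position⇒H11 (inTail m) _ =
    inj₂ (subst (λ t → suc t * aₖ k ≤ suc T * aₖ k + m) (sym tₖ≡T)
                (m≤m+n (suc T * aₖ k) m))

  position⇔H11 : ∀ x → HasPosition x ⇔ H11 k x
  position⇔H11 x = mk⇔ (λ { (p , valid , refl) → position⇒H11 p valid }) H11⇒position

  G⇔H11 : ∀ x → Gₖ k x ⇔ H11 k x
  G⇔H11 x = position⇔H11 x ⇔-∘ (normal-form⇔position x ⇔-∘ G⇔normal-form)
    where
    G⇔normal-form : Gₖ k x ⇔ NormalForm (aₖ k) h x
    G⇔normal-form = subst (λ H → Gₖ k x ⇔ NormalForm (aₖ k) H x) aₖ/2≡h
                      (generated⇔normal-form (aₖ k) (aₖ k / 2) x)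

  multiple-of-3 : ∀ {x} q → x ≡ q * 3 → x % 3 ≡ 0
  multiple-of-3 {x} q x≡3q = n∣m⇒m%n≡0 x 3 (divides q x≡3q)

  -- From the end of Aᵢ to the start of Bᵢ the value jumps by h − i, from the end of Bᵢ
  -- to the start of Aᵢ₊₁ by h + 1 − i. As h ≡ 2 (mod 3), the jump is ≡ 1 (mod 3) exactly
  -- when the index of its source is not a multiple of 3.
  A-end-residue : ∀ i → (i * i + i) % 3 ≢ 0 →
    (i * aₖ k + h + 0) % 3 ≡ suc (i * aₖ k + i) % 3
  A-end-residue i ≢0 with i divMod 3
  ... | result p zero refl =
    contradiction (multiple-of-3 (p * p * 3 + p) (identity p)) ≢0
    where
    identity : ∀ p → p * 3 * (p * 3) + p * 3 ≡ (p * p * 3 + p) * 3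
    identity = solve-∀
  ... | result p (suc zero) refl = m+jn≡o+kn⇒m%n≡o%n p k 3 (identity k p)
    where
    identity : ∀ k p → let i = 1 + p * 3 in
      i * (6 * k + 4) + suc (3 * k + 1) + 0 + p * 3 ≡ suc (i * (6 * k + 4) + i) + k * 3
    identity = solve-∀
  ... | result p (suc (suc zero)) refl =
    contradiction (multiple-of-3 ((2 + p * 3) * (1 + p)) (identity p)) ≢0
    where
    identity : ∀ p → (2 + p * 3) * (2 + p * 3) + (2 + p * 3) ≡ (2 + p * 3) * (1 + p) * 3
    identity = solve-∀

  B-end-residue : ∀ i → (suc i * suc i + suc i + suc i) % 3 ≢ 0 →
    (suc (suc i) * aₖ k + 0) % 3 ≡ suc (suc i * aₖ k + h + i) % 3
  B-end-residue i ≢0 with i divMod 3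
  ... | result p zero refl =
    contradiction (multiple-of-3 ((1 + p * 3) * (1 + p)) (identity p)) ≢0
    where
    identity : ∀ p → let i = 1 + p * 3 in i * i + i + i ≡ i * (1 + p) * 3
    identity = solve-∀
  ... | result p (suc zero) refl = m+jn≡o+kn⇒m%n≡o%n p k 3 (identity k p)
    where
    identity : ∀ k p → let i = 1 + p * 3 in
      suc (suc i) * (6 * k + 4) + 0 + p * 3
        ≡ suc (suc i * (6 * k + 4) + suc (3 * k + 1) + i) + k * 3
    identity = solve-∀
  ... | result p (suc (suc zero)) refl =
    contradiction (multiple-of-3 ((1 + p) * (5 + p * 3)) (identity p)) ≢0
    where
    identity : ∀ p → let i = 3 + p * 3 in i * i + i + i ≡ (1 + p) * (5 + p * 3) * 3
    identity = solve-∀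

  ⟶-residue : ∀ {p q} → p ⟶ q → index p % 3 ≢ 0 → value q % 3 ≡ suc (value p) % 3
  ⟶-residue {inA i d} (A-step _ _) _     = cong (_% 3) (+-suc (i * aₖ k) d)
  ⟶-residue A₀-end ≢0                   = contradiction refl ≢0
  ⟶-residue {inA (suc i) _} (A-end _) ≢0 = A-end-residue (suc i) ≢0
  ⟶-residue {inB i e} (B-step _ _) _     = cong (_% 3) (+-suc (i * aₖ k + h) e)
  ⟶-residue (B-end {i} _) ≢0             = B-end-residue i ≢0
  ⟶-residue (B-last {i} i+1≡T) ≢0        =
    subst (λ t → (suc t * aₖ k + 0) % 3 ≡ suc (suc i * aₖ k + h + i) % 3) i+1≡T
      (B-end-residue i ≢0)
  ⟶-residue {inTail m} tail-step _       = cong (_% 3) (+-suc (suc T * aₖ k) m)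

  g : ℕ → ℕ
  g n = value (walk n)

  g-residue : ∀ n → n % 3 ≢ 0 → g (suc n) % 3 ≡ suc (g n) % 3
  g-residue n ≢0 =
    ⟶-residue (walk-⟶ n) (subst (λ m → m % 3 ≢ 0) (sym (index-walk n)) ≢0)

  g-triples : ∀ m → AllResiduesOnce 3 (λ j → g (m * 3 + j))
  g-triples m = consecutive⇒all-residues-once 3 (λ j → g (m * 3 + j)) step
    where
    step : ∀ j → 1 ≤ j → j < 3 → g (m * 3 + suc j) % 3 ≡ suc (g (m * 3 + j)) % 3
    step j 1≤j j<3 =
      trans (cong (λ n → g n % 3) (+-suc (m * 3) j)) (g-residue (m * 3 + j) ≢0)
      where
      ≢0 : (m * 3 + j) % 3 ≢ 0
      ≢0 ≡0 = <⇒≢ 1≤j (begin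
        0                ≡⟨ ≡0 ⟨
        (m * 3 + j) % 3  ≡⟨ cong (_% 3) (+-comm (m * 3) j) ⟩
        (j + m * 3) % 3  ≡⟨ [m+kn]%n≡m%n j m 3 ⟩
        j % 3            ≡⟨ m<n⇒m%n≡m j<3 ⟩
        j                ∎)
        where open ≡-Reasoning

  generators : ∀ s → Sₖ k s ⇔ (∃ λ j → 1 ≤ j × j ≤ 3 × s ≡ g j)
  generators s = mk⇔ to from
    where
    g1 : g 1 ≡ aₖ k
    g1 = trans (+-identityʳ (1 * aₖ k)) (*-identityˡ (aₖ k))
    g2 : g 2 ≡ bₖ k
    g2 = cong (_+ 1) (*-identityˡ (aₖ k))
    g3 : g 3 ≡ cₖ k
    g3 = trans (+-identityʳ (1 * aₖ k + h))
               (cong₂ _+_ (*-identityˡ (aₖ k)) (sym aₖ/2≡h))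

    to : Sₖ k s → ∃ λ j → 1 ≤ j × j ≤ 3 × s ≡ g j
    to (inj₁ refl)        = 1 , s≤s z≤n , s≤s z≤n , sym g1
    to (inj₂ (inj₁ refl)) = 2 , s≤s z≤n , s≤s (s≤s z≤n) , sym g2
    to (inj₂ (inj₂ refl)) = 3 , s≤s z≤n , ≤-refl , sym g3

    from : (∃ λ j → 1 ≤ j × j ≤ 3 × s ≡ g j) → Sₖ k s
    from (1 , _ , _ , refl) = inj₁ g1
    from (2 , _ , _ , refl) = inj₂ (inj₁ g2)
    from (3 , _ , _ , refl) = inj₂ (inj₂ g3)
    from (suc (suc (suc (suc _))) , _ , s≤s (s≤s (s≤s ())) , _)

  H11-numerical : IsNumericalSemigroup (H11 k)
  H11-numerical = record
    { has-zero = to (G⇔H11 0) gen-zero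
    ; closed-+ = λ x∈H y∈H →
        to (G⇔H11 _) (⟨⟩-+ (from (G⇔H11 _) x∈H) (from (G⇔H11 _) y∈H))
    ; cofinite = suc (tₖ k) * aₖ k , λ x → inj₂
    }
    where open Equivalence

  H11-permutation : IsPermutationNS 3 (H11 k)
  H11-permutation =
    H11-numerical ,
    g ,
    Enumerates-⇔ position⇔H11 walk-enumerates ,
    (λ x → ⟨⟩-cong generators x ⇔-∘ ⇔-sym (G⇔H11 x)) ,
    g-triples

lemma4p11 : ∀ (k : ℕ) → 1 ≤ k →
    (∀ x → Gₖ k x ⇔ (∃ λ q → ∃ λ r → ∃ λ u →
        r ≤ q × x ≡ (q + u) * aₖ k + u * (aₖ k / 2) + r)) ×
    (∀ x → Gₖ k x ⇔ H11 k x) ×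
    IsPermutationNS 3 (H11 k)
lemma4p11 k _ = generated⇔normal-form (aₖ k) (aₖ k / 2) , G⇔H11 , H11-permutation
  where open Family k
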